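{- Let $\mathfrak g\ge0$, $h\ge1$, $r\ge0$ and integers $1<m_1\le\dots\le m_r$. Let $\Gamma$ be the group with generators $x_1,\dots,x_r,e_1,\dots,e_h,c_1,\dots,c_h,a_1,b_1,\dots,a_{\mathfrak g},b_{\mathfrak g}$ and relations $$\prod_{i=1}^r x_i\prod_{j=1}^h e_j\prod_{k=1}^{\mathfrak g}[a_k,b_k]=1,\quad x_i^{m_i}=1,\quad c_j^2=1,\quad [c_j,e_j]=1.$$ Then for every integer $d\ge1$ the number $\mathrm{Hom}_o^+(\Gamma,\mathbb{Z}_{2d})$ of order- and sign-preserving homomorphisms $\Gamma\to\mathbb{Z}_{2d}$ equals $d^{2\mathfrak g+h-1}\prod_{i=1}^r\phi(m_i)$ if $d$ is odd and $m_i\mid d$ for all $i$, and $0$ otherwise.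
   Context: A homomorphism $\psi:\Gamma\to\mathbb{Z}_{2d}$ is order-preserving if $\psi(x_i)$ has order exactly $m_i$ for each $i$ and $\psi(c_j)$ has order exactly $2$ for each $j$. Sign structures: $\sigma:\Gamma\to\{\pm1\}$ with $\sigma(x_i)=\sigma(e_j)=\sigma(a_k)=\sigma(b_k)=+1$, $\sigma(c_j)=-1$; $\sigma':\mathbb{Z}_{2d}\to\{\pm1\}$ with $\sigma'$ equal to $+1$ on even and $-1$ on odd residues. $\psi$ is sign-preserving if $\sigma'\circ\psi=\sigma$. $\phi$ is Euler's totient function. -}

module Defs where

open import Data.Nat using (ℕ; zero; suc; _+_; _*_; _∸_; _^_; _≤_; _<_; _≟_)
open import Data.Nat.Divisibility using (_∣_; _∣?_)
open import Data.Nat.GCD using (gcd)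
open import Data.Nat.Properties using (_<?_)
open import Data.Fin using (Fin; toℕ)
open import Data.Fin.Properties using (all?)
open import Data.Vec using (Vec; lookup; []; _∷_)
open import Data.List using (List; []; _∷_; _++_; map; concatMap; length; filter; replicate; allFin; upTo)
open import Data.Nat.ListAction using (product)
open import Data.List.Relation.Unary.All using (All)
import Data.List.Relation.Unary.All as All
open import Data.Product using (_×_; _,_)
open import Data.Product.Properties using ()
open import Relation.Nullary using (¬_; Dec; yes; no)
open import Relation.Nullary.Decidable using (_×-dec_; ¬?; _→-dec_)
open import Data.Bool using (Bool; true; false)

φ : ℕ → ℕ
φ m = length (filter (λ k → gcd (suc k) m ≟ 1) (upTo m))

data Gen (r h 𝔤 : ℕ) : Set where
  x : Fin r → Gen r h 𝔤
  e : Fin h → Gen r h 𝔤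
  c : Fin h → Gen r h 𝔤
  a : Fin 𝔤 → Gen r h 𝔤
  b : Fin 𝔤 → Gen r h 𝔤

-- A letter is a generator together with an exponent ±1 (false = +1, true = -1).
Word : (r h 𝔤 : ℕ) → Set
Word r h 𝔤 = List (Gen r h 𝔤 × Bool)

comm : ∀ {r h 𝔤} → Gen r h 𝔤 → Gen r h 𝔤 → Word r h 𝔤
comm u v = (u , false) ∷ (v , false) ∷ (u , true) ∷ (v , true) ∷ []

relators : ∀ r h 𝔤 → Vec ℕ r → List (Word r h 𝔤)
relators r h 𝔤 m =
  mainRel ∷ (map powRel (allFin r) ++ map cRel (allFin h) ++ map ceRel (allFin h))
  where
  mainRel : Word r h 𝔤
  mainRel = map (λ i → x i , false) (allFin r)
         ++ map (λ j → e j , false) (allFin h)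
         ++ concatMap (λ k → comm (a k) (b k)) (allFin 𝔤)
  powRel : Fin r → Word r h 𝔤
  powRel i = replicate (lookup m i) (x i , false)
  cRel : Fin h → Word r h 𝔤
  cRel j = (c j , false) ∷ (c j , false) ∷ []
  ceRel : Fin h → Word r h 𝔤
  ceRel j = comm (c j) (e j)

-- The cyclic group ℤ_n, with elements represented by Fin n
-- (residues 0..n-1); the group operation is addition mod n, so a
-- natural number v represents the identity iff n ∣ v.

-- Value (a natural number representing an element of ℤ_n) of a word
-- under an assignment of generators; the inverse of y is n - y.
evalWord : ∀ {r h 𝔤} (n : ℕ) → (Gen r h 𝔤 → Fin n) → Word r h 𝔤 → ℕ
evalWord n ψ [] = 0
evalWord n ψ ((s , false) ∷ w) = toℕ (ψ s) + evalWord n ψ w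
evalWord n ψ ((s , true)  ∷ w) = (n ∸ toℕ (ψ s)) + evalWord n ψ w

-- An assignment of generators extends to a homomorphism Γ → ℤ_n iff
-- every relator evaluates to the identity.
IsHom : ∀ {r h 𝔤} (n : ℕ) (m : Vec ℕ r) → (Gen r h 𝔤 → Fin n) → Set
IsHom {r} {h} {𝔤} n m ψ = All (λ w → n ∣ evalWord n ψ w) (relators r h 𝔤 m)

HasOrder : (n : ℕ) → Fin n → ℕ → Set
HasOrder n y k = (n ∣ k * toℕ y) × (∀ (j : Fin k) → 0 < toℕ j → ¬ (n ∣ toℕ j * toℕ y))

σ'IsPlus : ∀ {n} → Fin n → Set
σ'IsPlus y = 2 ∣ toℕ y

σIsPlus : ∀ {r h 𝔤} → Gen r h 𝔤 → Bool
σIsPlus (x _) = true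
σIsPlus (e _) = true
σIsPlus (c _) = false
σIsPlus (a _) = true
σIsPlus (b _) = true

SignMatch : ∀ {n} → Bool → Fin n → Set
SignMatch true  y = σ'IsPlus y
SignMatch false y = ¬ σ'IsPlus y

Assignment : (n r h 𝔤 : ℕ) → Set
Assignment n r h 𝔤 = Vec (Fin n) r × Vec (Fin n) h × Vec (Fin n) h × Vec (Fin n) 𝔤 × Vec (Fin n) 𝔤

toMap : ∀ {n r h 𝔤} → Assignment n r h 𝔤 → Gen r h 𝔤 → Fin n
toMap (xs , es , cs , as , bs) (x i) = lookup xs i
toMap (xs , es , cs , as , bs) (e j) = lookup es j
toMap (xs , es , cs , as , bs) (c j) = lookup cs j
toMap (xs , es , cs , as , bs) (a k) = lookup as k
toMap (xs , es , cs , as , bs) (b k) = lookup bs k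

allVecs : ∀ n k → List (Vec (Fin n) k)
allVecs n zero = [] ∷ []
allVecs n (suc k) = concatMap (λ v → map (_∷ v) (allFin n)) (allVecs n k)

allAssignments : ∀ n r h 𝔤 → List (Assignment n r h 𝔤)
allAssignments n r h 𝔤 =
  concatMap (λ xs → concatMap (λ es → concatMap (λ cs → concatMap (λ as →
    map (λ bs → xs , es , cs , as , bs) (allVecs n 𝔤)) (allVecs n 𝔤)) (allVecs n h)) (allVecs n h)) (allVecs n r)

IsHomOPlus : ∀ {r h 𝔤} (n : ℕ) (m : Vec ℕ r) → Assignment n r h 𝔤 → Set
IsHomOPlus {r} {h} {𝔤} n m α =
  IsHom n m ψ
  × (∀ i → HasOrder n (ψ (x i)) (lookup m i))
  × (∀ j → HasOrder n (ψ (c j)) 2)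
  × (∀ (s : Gen r h 𝔤) → SignMatch (σIsPlus s) (ψ s))
  where ψ = toMap α

hasOrder? : ∀ n y k → Dec (HasOrder n y k)
hasOrder? n y k = (n ∣? (k * toℕ y)) ×-dec all? (λ j → (0 <? toℕ j) →-dec ¬? (n ∣? (toℕ j * toℕ y)))

signMatch? : ∀ {n} s (y : Fin n) → Dec (SignMatch s y)
signMatch? true  y = 2 ∣? toℕ y
signMatch? false y = ¬? (2 ∣? toℕ y)

allGen? : ∀ {r h 𝔤 ℓ} {P : Gen r h 𝔤 → Set ℓ} → (∀ s → Dec (P s)) → Dec (∀ s → P s)
allGen? {P = P} P? with all? (λ i → P? (x i)) | all? (λ j → P? (e j)) | all? (λ j → P? (c j))
                      | all? (λ k → P? (a k)) | all? (λ k → P? (b k))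
... | yes px | yes pe | yes pc | yes pa | yes pb =
  yes λ { (x i) → px i ; (e j) → pe j ; (c j) → pc j ; (a k) → pa k ; (b k) → pb k }
... | no ¬p | _ | _ | _ | _ = no λ f → ¬p (λ i → f (x i))
... | yes _ | no ¬p | _ | _ | _ = no λ f → ¬p (λ i → f (e i))
... | yes _ | yes _ | no ¬p | _ | _ = no λ f → ¬p (λ i → f (c i))
... | yes _ | yes _ | yes _ | no ¬p | _ = no λ f → ¬p (λ i → f (a i))
... | yes _ | yes _ | yes _ | yes _ | no ¬p = no λ f → ¬p (λ i → f (b i))

isHomOPlus? : ∀ {r h 𝔤} n (m : Vec ℕ r) (α : Assignment n r h 𝔤) → Dec (IsHomOPlus n m α)
isHomOPlus? n m α =
  All.all? (λ w → n ∣? evalWord n (toMap α) w) _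
  ×-dec all? (λ i → hasOrder? n (toMap α (x i)) (lookup m i))
  ×-dec all? (λ j → hasOrder? n (toMap α (c j)) 2)
  ×-dec allGen? (λ s → signMatch? (σIsPlus s) (toMap α s))

countHomOPlus : (𝔤 h r : ℕ) → Vec ℕ r → (d : ℕ) → ℕ
countHomOPlus 𝔤 h r m d = length (filter (isHomOPlus? (2 * d) m) (allAssignments (2 * d) r h 𝔤))

prodφ : ∀ {r} → Vec ℕ r → ℕ
prodφ {r} m = product (map (λ i → φ (lookup m i)) (allFin r))

{-# OPTIONS --safe #-}
module Submission where

-- In ℤ_{2d} the sign condition forces the images of x_i, e_j, a_k, b_k to be even residues and
-- those of the c_j to be odd, while c_j of order 2 forces c_j ↦ d; as h ≥ 1 this makes d odd, and
-- then every relation involving a c_j holds automatically. The even residues form a copy of ℤ_d via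
-- z ↦ 2z, in which x_i must have order m_i: this needs m_i ∣ d and leaves φ(m_i) choices (writing
-- d = m_i q, these are the t q with t coprime to m_i). Commutators vanish in the abelian target, so
-- the long relation only asks Σ x_i + Σ e_j ≡ 0, which determines one e_j among the even residues
-- and leaves the other h - 1 free, while each a_k and b_k has d choices.

open import Defs
open import Level using (Level)
open import Function using (_∘_; id; _⇔_; mk⇔; Equivalence)
open import Data.Bool using (true; false; if_then_else_)
open import Data.Nat using (ℕ; zero; suc; _+_; _*_; _∸_; _^_; _≤_; _<_; _≟_; NonZero; z≤n; z<s; s<s;
  ≢-nonZero; ≢-nonZero⁻¹; >-nonZero; _/_; _%_)
open import Data.Nat.Properties
open import Data.Nat.Divisibility
open import Data.Nat.DivMod using (m≡m%n+[m/n]*n; m%n<n)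
open import Data.Nat.GCD using (gcd)
open import Data.Nat.Coprimality using (Coprime; coprime?; coprime-+; coprime-divisor; gcd≡1⇒coprime; coprime⇒gcd≡1)
import Data.Nat.Coprimality as Coprimality
open import Data.Nat.ListAction using (sum; product)
open import Data.Nat.Tactic.RingSolver using (solve-∀)
open import Data.Fin using (Fin; toℕ; fromℕ<) renaming (zero to fzero; suc to fsuc)
open import Data.Fin.Properties using (all?; toℕ-fromℕ<; toℕ<n)
open import Data.Vec using (Vec; lookup; []; _∷_)
open import Data.List using (List; []; _∷_; _++_; map; concatMap; length; filter; tabulate; applyUpTo; allFin;
  cartesianProduct; replicate)
open import Data.List.Properties using (filter-++; length-++; filter-≐; filter-none; map-∘; map-++; map-id;
  map-tabulate; tabulate-cong)
open import Data.List.Relation.Unary.All using (_∷_; universal)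
open import Data.List.Relation.Unary.All.Properties using (++⁺; map⁺; tabulate⁺)
open import Data.Product using (_×_; _,_; proj₁; proj₂)
open import Relation.Nullary using (¬_; Dec; does; yes; no; contradiction)
open import Relation.Nullary.Decidable using (_×-dec_; _→-dec_; ¬?)
open import Relation.Unary using (Pred; Decidable)
open import Relation.Unary.Properties using (U?)
open import Relation.Binary.PropositionalEquality

private
  variable
    ℓ ℓ′ ℓ″ p p′ : Level
    A : Set ℓ
    B : Set ℓ′
    C : Set ℓ″

-- Counting elements of lists

𝟙 : {P : Set p} → Dec P → ℕ
𝟙 P? = if does P? then 1 else 0

module _ {P : Set p} where

  𝟙-yes : (P? : Dec P) → P → 𝟙 P? ≡ 1
  𝟙-yes (yes _) _     = refl
  𝟙-yes (no ¬P) holds = contradiction holds ¬P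

  𝟙-no : (P? : Dec P) → ¬ P → 𝟙 P? ≡ 0
  𝟙-no (yes holds) ¬P = contradiction holds ¬P
  𝟙-no (no _)      _  = refl

  𝟙-cong : {Q : Set p′} (P? : Dec P) (Q? : Dec Q) → P ⇔ Q → 𝟙 P? ≡ 𝟙 Q?
  𝟙-cong P? (yes holds) P⇔Q = 𝟙-yes P? (Equivalence.from P⇔Q holds)
  𝟙-cong P? (no ¬Q)     P⇔Q = 𝟙-no P? (¬Q ∘ Equivalence.to P⇔Q)

count : {P : Pred A p} → Decidable P → List A → ℕ
count P? = length ∘ filter P?

module _ {P : Pred A p} (P? : Decidable P) where

  count-∷ : ∀ u us → count P? (u ∷ us) ≡ 𝟙 (P? u) + count P? us
  count-∷ u us with P? u
  ... | yes _ = refl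
  ... | no _  = refl

  count-++ : ∀ us vs → count P? (us ++ vs) ≡ count P? us + count P? vs
  count-++ us vs = trans (cong length (filter-++ P? us vs)) (length-++ (filter P? us))

  count-none : (∀ u → ¬ P u) → ∀ us → count P? us ≡ 0
  count-none ¬P us = cong length (filter-none P? (universal ¬P us))

  count-map : (f : B → A) → ∀ us → count P? (map f us) ≡ count (P? ∘ f) us
  count-map f []       = refl
  count-map f (u ∷ us) with does (P? (f u))
  ... | true  = cong suc (count-map f us)
  ... | false = count-map f us

count-cong : {P : Pred A p} {Q : Pred A p′} (P? : Decidable P) (Q? : Decidable Q) →
             (∀ u → P u ⇔ Q u) → ∀ us → count P? us ≡ count Q? us
count-cong P? Q? P⇔Q = cong length ∘ filter-≐ P? Q? (Equivalence.to (P⇔Q _) , Equivalence.from (P⇔Q _))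

count-cartesianProduct : {P : Pred A p} {Q : A → Pred B p′}
  (P? : Decidable P) (Q? : ∀ u → Decidable (Q u)) (us : List A) (vs : List B) {k : ℕ} →
  (∀ {u} → P u → count (Q? u) vs ≡ k) →
  count (λ (u , v) → P? u ×-dec Q? u v) (cartesianProduct us vs) ≡ count P? us * k
count-cartesianProduct P? Q? [] vs count-Q = refl
count-cartesianProduct {A = A} {B = B} {P = P} {Q = Q} P? Q? (u ∷ us) vs {k} count-Q = begin
  count R? (map (u ,_) vs ++ cartesianProduct us vs)
    ≡⟨ count-++ R? (map (u ,_) vs) _ ⟩
  count R? (map (u ,_) vs) + count R? (cartesianProduct us vs)
    ≡⟨ cong₂ _+_ (trans (count-map R? (u ,_) vs) (fibre (P? u))) (count-cartesianProduct P? Q? us vs count-Q) ⟩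
  𝟙 (P? u) * k + count P? us * k
    ≡⟨ *-distribʳ-+ k (𝟙 (P? u)) _ ⟨
  (𝟙 (P? u) + count P? us) * k
    ≡⟨ cong (_* k) (count-∷ P? u us) ⟨
  count P? (u ∷ us) * k ∎
  where
  open ≡-Reasoning
  R? : Decidable (λ ((u , v) : A × B) → P u × Q u v)
  R? (u , v) = P? u ×-dec Q? u v
  fibre : (P?u : Dec (P u)) → count (λ v → P?u ×-dec Q? u v) vs ≡ 𝟙 P?u * k
  fibre (yes Pu) = trans (count-cong _ (Q? u) (λ _ → mk⇔ proj₂ (Pu ,_)) vs) (trans (count-Q Pu) (sym (+-identityʳ k)))
  fibre (no ¬Pu) = count-none _ (λ _ → ¬Pu ∘ proj₁) vs

concatMap≡map-cartesianProduct : (f : A × B → C) {g : A → List C} {vs : List B} →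
  (∀ u → g u ≡ map (λ v → f (u , v)) vs) → ∀ us → concatMap g us ≡ map f (cartesianProduct us vs)
concatMap≡map-cartesianProduct f g≡ [] = refl
concatMap≡map-cartesianProduct f {g} {vs} g≡ (u ∷ us) = begin
  g u ++ concatMap g us
    ≡⟨ cong₂ _++_ (trans (g≡ u) (map-∘ vs)) (concatMap≡map-cartesianProduct f g≡ us) ⟩
  map f (map (u ,_) vs) ++ map f (cartesianProduct us vs)
    ≡⟨ map-++ f (map (u ,_) vs) _ ⟨
  map f (cartesianProduct (u ∷ us) vs) ∎
  where open ≡-Reasoning

-- Sums over initial segments of ℕ

∑< : ℕ → (ℕ → ℕ) → ℕ
∑< zero    f = 0
∑< (suc n) f = f 0 + ∑< n (f ∘ suc)

count-applyUpTo : {P : Pred A p} (P? : Decidable P) (f : ℕ → A) (n : ℕ) →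
                  count P? (applyUpTo f n) ≡ ∑< n (𝟙 ∘ P? ∘ f)
count-applyUpTo P? f zero    = refl
count-applyUpTo P? f (suc n) = trans (count-∷ P? (f 0) _) (cong (𝟙 (P? (f 0)) +_) (count-applyUpTo P? (f ∘ suc) n))

tabulate-∘toℕ : (f : ℕ → A) (n : ℕ) → tabulate (f ∘ toℕ {n}) ≡ applyUpTo f n
tabulate-∘toℕ f zero    = refl
tabulate-∘toℕ f (suc n) = cong (f 0 ∷_) (tabulate-∘toℕ (f ∘ suc) n)

count-allFin : {P : Pred ℕ p} (P? : Decidable P) (n : ℕ) → count (P? ∘ toℕ) (allFin n) ≡ ∑< n (𝟙 ∘ P?)
count-allFin P? n = begin
  count (P? ∘ toℕ) (allFin n)   ≡⟨ count-map P? toℕ (allFin n) ⟨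
  count P? (map toℕ (allFin n)) ≡⟨ cong (count P?) (trans (map-tabulate id toℕ) (tabulate-∘toℕ id n)) ⟩
  count P? (applyUpTo id n)     ≡⟨ count-applyUpTo P? id n ⟩
  ∑< n (𝟙 ∘ P?)                 ∎
  where open ≡-Reasoning

∑<-cong : ∀ n {f g} → (∀ {i} → i < n → f i ≡ g i) → ∑< n f ≡ ∑< n g
∑<-cong zero    f≗g = refl
∑<-cong (suc n) f≗g = cong₂ _+_ (f≗g z<s) (∑<-cong n (f≗g ∘ s<s))

∑<-const : ∀ n k → ∑< n (λ _ → k) ≡ n * k
∑<-const zero    k = refl
∑<-const (suc n) k = cong (k +_) (∑<-const n k)

∑<-zero : ∀ n {f} → (∀ {i} → i < n → f i ≡ 0) → ∑< n f ≡ 0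
∑<-zero n f≗0 = trans (∑<-cong n f≗0) (trans (∑<-const n 0) (*-zeroʳ n))

∑<-+ : ∀ m n f → ∑< (m + n) f ≡ ∑< m f + ∑< n (f ∘ (m +_))
∑<-+ zero    n f = refl
∑<-+ (suc m) n f = trans (cong (f 0 +_) (∑<-+ m n (f ∘ suc))) (sym (+-assoc (f 0) _ _))

∑<-* : ∀ k q f → ∑< (k * q) f ≡ ∑< k (λ t → ∑< q (λ s → f (t * q + s)))
∑<-* zero    q f = refl
∑<-* (suc k) q f = trans (∑<-+ q (k * q) f) (cong (∑< q f +_) (trans (∑<-* k q (f ∘ (q +_)))
  (∑<-cong k (λ {t} _ → ∑<-cong q (λ {s} _ → cong f (sym (+-assoc q (t * q) s)))))))

∑<-rotate : ∀ n f → ∑< n (f ∘ suc) + f 0 ≡ ∑< n f + f n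
∑<-rotate n f = begin
  ∑< n (f ∘ suc) + f 0       ≡⟨ +-comm _ (f 0) ⟩
  ∑< (suc n) f               ≡⟨ cong (λ k → ∑< k f) (+-comm 1 n) ⟩
  ∑< (n + 1) f               ≡⟨ ∑<-+ n 1 f ⟩
  ∑< n f + (f (n + 0) + 0)   ≡⟨ cong (∑< n f +_) (trans (+-identityʳ _) (cong f (+-identityʳ n))) ⟩
  ∑< n f + f n               ∎
  where open ≡-Reasoning

∑<-periodic : ∀ n u f → (∀ i → f (n + i) ≡ f i) → ∑< n (f ∘ (u +_)) ≡ ∑< n f
∑<-periodic n zero    f periodic = refl
∑<-periodic n (suc u) f periodic = trans (∑<-periodic n u (f ∘ suc) periodic-suc) shift
  where
  periodic-suc : ∀ i → f (suc (n + i)) ≡ f (suc i)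
  periodic-suc i = trans (cong f (sym (+-suc n i))) (periodic (suc i))
  shift : ∑< n (f ∘ suc) ≡ ∑< n f
  shift = +-cancelʳ-≡ (f 0) _ _ (trans (∑<-rotate n f)
            (cong (∑< n f +_) (trans (cong f (sym (+-identityʳ n))) (periodic 0))))

-- 𝟙 (suc v ≟ suc w) and 𝟙 (v ≟ w) compute to the same test v ≡ᵇ w.
∑<-𝟙≟ : ∀ {n w} → w < n → ∑< n (λ v → 𝟙 (v ≟ w)) ≡ 1
∑<-𝟙≟ {suc n} {zero}  _         = cong suc (trans (∑<-const n 0) (*-zeroʳ n))
∑<-𝟙≟ {suc n} {suc w} (s<s w<n) = ∑<-𝟙≟ w<n

¬2∣odd : ∀ z → ¬ 2 ∣ z * 2 + 1
¬2∣odd z 2∣odd = contradiction (∣1⇒≡1 (∣m+n∣m⇒∣n 2∣odd (n∣m*n z))) λ ()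

∑<-evens : ∀ d {P : Pred ℕ p} (P? : Decidable P) →
  ∑< (2 * d) (λ y → 𝟙 (P? y ×-dec 2 ∣? y)) ≡ ∑< d (λ z → 𝟙 (P? (2 * z)))
∑<-evens d P? = begin
  ∑< (2 * d) f                                      ≡⟨ cong (λ k → ∑< k f) (*-comm 2 d) ⟩
  ∑< (d * 2) f                                      ≡⟨ ∑<-* d 2 f ⟩
  ∑< d (λ z → f (z * 2 + 0) + (f (z * 2 + 1) + 0))  ≡⟨ ∑<-cong d (λ {z} _ → cong₂ _+_ (even z) (odd z)) ⟩
  ∑< d (λ z → 𝟙 (P? (2 * z)) + 0)                   ≡⟨ ∑<-cong d (λ _ → +-identityʳ _) ⟩
  ∑< d (λ z → 𝟙 (P? (2 * z)))                       ∎
  where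
  open ≡-Reasoning
  f : ℕ → ℕ
  f y = 𝟙 (P? y ×-dec 2 ∣? y)
  even : ∀ z → f (z * 2 + 0) ≡ 𝟙 (P? (2 * z))
  even z = trans (cong f (trans (+-identityʳ (z * 2)) (*-comm z 2)))
                 (𝟙-cong (P? (2 * z) ×-dec 2 ∣? (2 * z)) (P? (2 * z)) (mk⇔ proj₁ (_, m∣m*n z)))
  odd : ∀ z → f (z * 2 + 1) + 0 ≡ 0
  odd z = trans (+-identityʳ _) (𝟙-no (P? (z * 2 + 1) ×-dec 2 ∣? (z * 2 + 1)) (¬2∣odd z ∘ proj₂))

∑<-divisible : ∀ d .{{_ : NonZero d}} u → ∑< d (λ z → 𝟙 (d ∣? u + z)) ≡ 1
∑<-divisible d@(suc d′) u =
  trans (∑<-periodic d u (λ z → 𝟙 (d ∣? z)) (λ i → 𝟙-cong (d ∣? d + i) (d ∣? i) shift))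
  (cong₂ _+_ (𝟙-yes (d ∣? 0) (d ∣0)) (∑<-zero d′ λ {z} z<d′ → 𝟙-no (d ∣? suc z) (>⇒∤ (s<s z<d′))))
  where
  shift : ∀ {i} → d ∣ d + i ⇔ d ∣ i
  shift = mk⇔ (λ d∣d+i → ∣m+n∣m⇒∣n d∣d+i ∣-refl) (∣m∣n⇒∣m+n ∣-refl)

entrywise? : ∀ {k} {P : Fin k → Pred A p} → (∀ i → Decidable (P i)) →
             Decidable (λ (v : Vec A k) → ∀ i → P i (lookup v i))
entrywise? P? v = all? (λ i → P? i (lookup v i))

allVecs-suc : ∀ n k → allVecs n (suc k) ≡ map (λ (v , y) → y ∷ v) (cartesianProduct (allVecs n k) (allFin n))
allVecs-suc n k = concatMap≡map-cartesianProduct (λ (v , y) → y ∷ v) (λ _ → refl) (allVecs n k)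

allAssignments≡cartesianProduct : ∀ n r h 𝔤 → allAssignments n r h 𝔤 ≡
  cartesianProduct (allVecs n r) (cartesianProduct (allVecs n h)
    (cartesianProduct (allVecs n h) (cartesianProduct (allVecs n 𝔤) (allVecs n 𝔤))))
allAssignments≡cartesianProduct n r h 𝔤 = trans
  (concatMap≡map-cartesianProduct id (λ xs →
    concatMap≡map-cartesianProduct (xs ,_) (λ es →
      concatMap≡map-cartesianProduct (λ p → xs , es , p) (λ cs →
        concatMap≡map-cartesianProduct (λ p → xs , es , cs , p) (λ _ → refl) (allVecs n 𝔤))
      (allVecs n h))
    (allVecs n h))
  (allVecs n r))
  (map-id _)

count-allVecs : ∀ n k {P : Fin k → Pred (Fin n) p} (P? : ∀ i → Decidable (P i)) →
  count (entrywise? P?) (allVecs n k) ≡ product (tabulate (λ i → count (P? i) (allFin n)))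
count-allVecs n zero    P? = refl
count-allVecs n (suc k) {P} P? = begin
  count (entrywise? P?) (allVecs n (suc k))
    ≡⟨ cong (count (entrywise? P?)) (allVecs-suc n k) ⟩
  count (entrywise? P?) (map (λ (v , y) → y ∷ v) pairs)
    ≡⟨ count-map (entrywise? P?) _ pairs ⟩
  count (λ (v , y) → entrywise? P? (y ∷ v)) pairs
    ≡⟨ count-cong _ (λ (v , y) → entrywise? (P? ∘ fsuc) v ×-dec P? fzero y) (λ _ → split) pairs ⟩
  count (λ (v , y) → entrywise? (P? ∘ fsuc) v ×-dec P? fzero y) pairs
    ≡⟨ count-cartesianProduct (entrywise? (P? ∘ fsuc)) (λ _ → P? fzero) (allVecs n k) (allFin n) (λ _ → refl) ⟩
  count (entrywise? (P? ∘ fsuc)) (allVecs n k) * count (P? fzero) (allFin n)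
    ≡⟨ cong (_* count (P? fzero) (allFin n)) (count-allVecs n k (P? ∘ fsuc)) ⟩
  product (tabulate (λ i → count (P? (fsuc i)) (allFin n))) * count (P? fzero) (allFin n)
    ≡⟨ *-comm _ (count (P? fzero) (allFin n)) ⟩
  product (tabulate (λ i → count (P? i) (allFin n))) ∎
  where
  open ≡-Reasoning
  pairs : List (Vec (Fin n) k × Fin n)
  pairs = cartesianProduct (allVecs n k) (allFin n)
  split : ∀ {v y} → (∀ i → P i (lookup (y ∷ v) i)) ⇔ ((∀ i → P (fsuc i) (lookup v i)) × P fzero y)
  split = mk⇔ (λ P[y∷v] → P[y∷v] ∘ fsuc , P[y∷v] fzero)
              (λ { (P[v] , P[y]) fzero → P[y] ; (P[v] , P[y]) (fsuc i) → P[v] i })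

product-tabulate-const : ∀ k w → product (tabulate {n = k} (λ _ → w)) ≡ w ^ k
product-tabulate-const zero    w = refl
product-tabulate-const (suc k) w = cong (w *_) (product-tabulate-const k w)

-- Orders of residues

-- HasOrder n y k unfolds to HasOrderℕ n (toℕ y) k.
HasOrderℕ : ℕ → ℕ → ℕ → Set
HasOrderℕ n v k = (n ∣ k * v) × (∀ (j : Fin k) → 0 < toℕ j → ¬ (n ∣ toℕ j * v))

hasOrderℕ? : ∀ n v k → Dec (HasOrderℕ n v k)
hasOrderℕ? n v k = (n ∣? (k * v)) ×-dec all? (λ j → (0 <? toℕ j) →-dec ¬? (n ∣? (toℕ j * v)))

hasOrderℕ-minimal : ∀ {n v k j} → HasOrderℕ n v k → 0 < j → n ∣ j * v → k ≤ j
hasOrderℕ-minimal {n} {v} (_ , ¬n∣) 0<j n∣jv = ≮⇒≥ λ j<k →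
  ¬n∣ (fromℕ< j<k) (subst (0 <_) (sym (toℕ-fromℕ< j<k)) 0<j)
       (subst (λ i → n ∣ i * v) (sym (toℕ-fromℕ< j<k)) n∣jv)

-- n % k also kills v, so by minimality it is 0.
hasOrderℕ⇒∣ : ∀ {n v k} .{{_ : NonZero k}} → HasOrderℕ n v k → k ∣ n
hasOrderℕ⇒∣ {n} {v} {k} order@(n∣kv , _) =
  m%n≡0⇒n∣m n k (n≤0⇒n≡0 (≮⇒≥ λ 0<r → <⇒≱ (m%n<n n k) (hasOrderℕ-minimal order 0<r n∣rv)))
  where
  rearrange : ∀ r q k v → (r + q * k) * v ≡ q * (k * v) + r * v
  rearrange = solve-∀
  n∣rv : n ∣ n % k * v
  n∣rv = ∣m+n∣m⇒∣n
    (subst (n ∣_) (trans (cong (_* v) (m≡m%n+[m/n]*n n k)) (rearrange (n % k) (n / k) k v)) (m∣m*n v))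
    (∣n⇒∣m*n (n / k) n∣kv)

2*-∣⇔ : ∀ n w → 2 * n ∣ 2 * w ⇔ n ∣ w
2*-∣⇔ n w = mk⇔ (*-cancelˡ-∣ 2) (*-monoʳ-∣ 2)

hasOrderℕ-2* : ∀ n v k → HasOrderℕ (2 * n) (2 * v) k ⇔ HasOrderℕ n v k
hasOrderℕ-2* n v k = mk⇔
  (λ (n∣kv , ¬n∣) → to (halve k) n∣kv , λ j 0<j → ¬n∣ j 0<j ∘ from (halve (toℕ j)))
  (λ (n∣kv , ¬n∣) → from (halve k) n∣kv , λ j 0<j → ¬n∣ j 0<j ∘ to (halve (toℕ j)))
  where
  open Equivalence
  swap : ∀ j v → j * (2 * v) ≡ 2 * (j * v)
  swap = solve-∀
  halve : ∀ j → 2 * n ∣ j * (2 * v) ⇔ n ∣ j * v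
  halve j = subst (λ w → 2 * n ∣ w ⇔ n ∣ j * v) (sym (swap j v)) (2*-∣⇔ n (j * v))

hasOrderℕ-two : ∀ {d v} → v < 2 * d → HasOrderℕ (2 * d) v 2 ⇔ v ≡ d
hasOrderℕ-two {zero}        ()
hasOrderℕ-two {d@(suc _)} {v} v<2d = mk⇔ to from
  where
  to : HasOrderℕ (2 * d) v 2 → v ≡ d
  to (2d∣2v , ¬2d∣) with *-cancelˡ-∣ 2 2d∣2v
  ... | divides zero          v≡0  =
    contradiction (subst (λ w → 2 * d ∣ 1 * w) (sym v≡0) ((2 * d) ∣0)) (¬2d∣ (fsuc fzero) z<s)
  ... | divides (suc zero)    v≡d  = trans v≡d (+-identityʳ d)
  ... | divides (suc (suc q)) v≡qd =
    contradiction v<2d (≤⇒≯ (subst (2 * d ≤_) (sym v≡qd) (+-monoʳ-≤ d (+-monoʳ-≤ d z≤n))))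
  from : v ≡ d → HasOrderℕ (2 * d) v 2
  from refl = ∣-refl , λ
    { fzero () ; (fsuc fzero) _ 2d∣d → <⇒≱ (subst (_< 2 * d) (sym (+-identityʳ d)) v<2d) (∣⇒≤ 2d∣d) }

hasOrderℕ-multiple : ∀ m q t .{{_ : NonZero m}} .{{_ : NonZero q}} → HasOrderℕ (m * q) (t * q) m ⇔ Coprime t m
hasOrderℕ-multiple m q t = mk⇔ to from
  where
  -- A common divisor g of t = t′ g and m = m′ g gives m * q ∣ m′ * (t * q), so m ≤ m′ and g = 1.
  to : HasOrderℕ (m * q) (t * q) m → Coprime t m
  to order {g} (divides t′ t≡t′g , divides m′ m≡m′g) = ≤-antisym g≤1 (n≢0⇒n>0 g≢0)
    where
    m≢0 : m ≢ 0
    m≢0 = ≢-nonZero⁻¹ m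
    m′≢0 : m′ ≢ 0
    m′≢0 refl = m≢0 m≡m′g
    g≢0 : g ≢ 0
    g≢0 refl = m≢0 (trans m≡m′g (*-zeroʳ m′))
    rearrange : ∀ m′ t′ g q → m′ * (t′ * g * q) ≡ t′ * (m′ * g * q)
    rearrange = solve-∀
    mq∣m′tq : m * q ∣ m′ * (t * q)
    mq∣m′tq = divides t′ (begin
      m′ * (t * q)        ≡⟨ cong (λ t → m′ * (t * q)) t≡t′g ⟩
      m′ * (t′ * g * q)   ≡⟨ rearrange m′ t′ g q ⟩
      t′ * (m′ * g * q)   ≡⟨ cong (λ m → t′ * (m * q)) m≡m′g ⟨
      t′ * (m * q)        ∎)
      where open ≡-Reasoning
    g≤1 : g ≤ 1
    g≤1 = *-cancelˡ-≤ m′ {{≢-nonZero m′≢0}}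
            (subst₂ _≤_ m≡m′g (sym (*-identityʳ m′)) (hasOrderℕ-minimal order (n≢0⇒n>0 m′≢0) mq∣m′tq))
  from : Coprime t m → HasOrderℕ (m * q) (t * q) m
  from coprime = divides t (rearrange m t q) , λ j 0<j mq∣jtq →
      <⇒≱ (toℕ<n j) (∣⇒≤ {{>-nonZero 0<j}} (coprime-divisor (Coprimality.sym coprime)
        (subst (m ∣_) (*-comm (toℕ j) t) (*-cancelʳ-∣ q (subst (m * q ∣_) (sym (*-assoc (toℕ j) t q)) mq∣jtq)))))
    where
    rearrange : ∀ m t q → m * (t * q) ≡ t * (m * q)
    rearrange = solve-∀

-- Writing v = t * q + s with s < q, v has order m exactly when s = 0 and t is coprime to m.
∑<-hasOrderℕ : ∀ m q .{{_ : NonZero m}} .{{_ : NonZero q}} →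
  ∑< (m * q) (λ v → 𝟙 (hasOrderℕ? (m * q) v m)) ≡ ∑< m (λ t → 𝟙 (coprime? t m))
∑<-hasOrderℕ m q@(suc q′) = trans (∑<-* m q _) (∑<-cong m (λ {t} _ → block t))
  where
  block : ∀ t → ∑< q (λ s → 𝟙 (hasOrderℕ? (m * q) (t * q + s) m)) ≡ 𝟙 (coprime? t m)
  block t = trans (cong₂ _+_ multiple-of-q non-multiples) (+-identityʳ _)
    where
    multiple-of-q : 𝟙 (hasOrderℕ? (m * q) (t * q + 0) m) ≡ 𝟙 (coprime? t m)
    multiple-of-q = trans (cong (λ v → 𝟙 (hasOrderℕ? (m * q) v m)) (+-identityʳ (t * q)))
                          (𝟙-cong (hasOrderℕ? (m * q) (t * q) m) (coprime? t m) (hasOrderℕ-multiple m q t))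
    non-multiples : ∑< q′ (λ s → 𝟙 (hasOrderℕ? (m * q) (t * q + suc s) m)) ≡ 0
    non-multiples = ∑<-zero q′ λ {s} s<q′ → 𝟙-no (hasOrderℕ? (m * q) (t * q + suc s) m) λ (mq∣m[tq+s] , _) →
      >⇒∤ (s<s s<q′) (∣m+n∣m⇒∣n (*-cancelˡ-∣ m mq∣m[tq+s]) (n∣m*n t))

-- φ counts 1 … m and the right-hand side 0 … m - 1; coprimality to m is m-periodic.
φ≡∑<-coprime : ∀ m → φ m ≡ ∑< m (λ t → 𝟙 (coprime? t m))
φ≡∑<-coprime m = begin
  φ m
    ≡⟨ count-applyUpTo (λ k → gcd (suc k) m ≟ 1) id m ⟩
  ∑< m (λ k → 𝟙 (gcd (suc k) m ≟ 1))
    ≡⟨ ∑<-cong m (λ {k} _ →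
         𝟙-cong (gcd (suc k) m ≟ 1) (coprime? (suc k) m) (mk⇔ gcd≡1⇒coprime coprime⇒gcd≡1)) ⟩
  ∑< m (λ k → 𝟙 (coprime? (1 + k) m))
    ≡⟨ ∑<-periodic m 1 (λ t → 𝟙 (coprime? t m)) (λ t → 𝟙-cong (coprime? (m + t) m) (coprime? t m) coprime-shift) ⟩
  ∑< m (λ t → 𝟙 (coprime? t m)) ∎
  where
  open ≡-Reasoning
  coprime-shift : ∀ {t} → Coprime (m + t) m ⇔ Coprime t m
  coprime-shift = mk⇔ (λ coprime {g} (g∣t , g∣m) → coprime (∣m∣n⇒∣m+n g∣m g∣t , g∣m))
                      (λ coprime {g} → coprime-+ coprime)

count-even : ∀ d → count (λ (y : Fin (2 * d)) → 2 ∣? toℕ y) (allFin (2 * d)) ≡ d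
count-even d = begin
  count (λ y → 2 ∣? toℕ y) (allFin (2 * d))  ≡⟨ count-allFin (2 ∣?_) (2 * d) ⟩
  ∑< (2 * d) (λ y → 𝟙 (U? y ×-dec 2 ∣? y))   ≡⟨ ∑<-evens d U? ⟩
  ∑< d (λ _ → 1)                             ≡⟨ ∑<-const d 1 ⟩
  d * 1                                      ≡⟨ *-identityʳ d ⟩
  d                                          ∎
  where open ≡-Reasoning

count-≡half : ∀ d .{{_ : NonZero d}} → count (λ (y : Fin (2 * d)) → toℕ y ≟ d) (allFin (2 * d)) ≡ 1
count-≡half d@(suc _) = trans (count-allFin (_≟ d) (2 * d)) (∑<-𝟙≟ (m<m+n d z<s))

count-hasOrder-even : ∀ d m .{{_ : NonZero m}} .{{_ : NonZero d}} → m ∣ d →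
  count (λ (y : Fin (2 * d)) → hasOrder? (2 * d) y m ×-dec 2 ∣? toℕ y) (allFin (2 * d)) ≡ φ m
count-hasOrder-even d m m∣d = begin
  count (λ y → hasOrder? (2 * d) y m ×-dec 2 ∣? toℕ y) (allFin (2 * d))
    ≡⟨ count-allFin (λ v → hasOrderℕ? (2 * d) v m ×-dec 2 ∣? v) (2 * d) ⟩
  ∑< (2 * d) (λ v → 𝟙 (hasOrderℕ? (2 * d) v m ×-dec 2 ∣? v))
    ≡⟨ ∑<-evens d (λ v → hasOrderℕ? (2 * d) v m) ⟩
  ∑< d (λ z → 𝟙 (hasOrderℕ? (2 * d) (2 * z) m))
    ≡⟨ ∑<-cong d (λ {z} _ → 𝟙-cong (hasOrderℕ? (2 * d) (2 * z) m) (hasOrderℕ? d z m) (hasOrderℕ-2* d z m)) ⟩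
  ∑< d (λ z → 𝟙 (hasOrderℕ? d z m))
    ≡⟨ cong (λ n → ∑< n (λ z → 𝟙 (hasOrderℕ? n z m))) (m∣n⇒n≡m*quotient m∣d) ⟩
  ∑< (m * q) (λ z → 𝟙 (hasOrderℕ? (m * q) z m))
    ≡⟨ ∑<-hasOrderℕ m q ⟩
  ∑< m (λ t → 𝟙 (coprime? t m))
    ≡⟨ φ≡∑<-coprime m ⟨
  φ m ∎
  where
  open ≡-Reasoning
  q : ℕ
  q = quotient m∣d
  instance
    q≢0 : NonZero q
    q≢0 = quotient≢0 m∣d

count-even-inverse : ∀ d .{{_ : NonZero d}} s → 2 ∣ s →
  count (λ (y : Fin (2 * d)) → 2 * d ∣? s + toℕ y ×-dec 2 ∣? toℕ y) (allFin (2 * d)) ≡ 1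
count-even-inverse d s (divides u s≡u*2) = begin
  count (λ y → 2 * d ∣? s + toℕ y ×-dec 2 ∣? toℕ y) (allFin (2 * d))
    ≡⟨ count-allFin (λ v → 2 * d ∣? s + v ×-dec 2 ∣? v) (2 * d) ⟩
  ∑< (2 * d) (λ v → 𝟙 (2 * d ∣? s + v ×-dec 2 ∣? v))
    ≡⟨ ∑<-evens d (λ v → 2 * d ∣? s + v) ⟩
  ∑< d (λ z → 𝟙 (2 * d ∣? s + 2 * z))
    ≡⟨ ∑<-cong d (λ {z} _ → 𝟙-cong (2 * d ∣? s + 2 * z) (d ∣? u + z) (halve z)) ⟩
  ∑< d (λ z → 𝟙 (d ∣? u + z))
    ≡⟨ ∑<-divisible d u ⟩
  1 ∎
  where
  open ≡-Reasoning
  factor : ∀ u z → u * 2 + 2 * z ≡ 2 * (u + z)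
  factor = solve-∀
  halve : ∀ z → 2 * d ∣ s + 2 * z ⇔ d ∣ u + z
  halve z = subst (λ w → 2 * d ∣ w ⇔ d ∣ u + z) (sym (trans (cong (_+ 2 * z) s≡u*2) (factor u z))) (2*-∣⇔ d (u + z))

sumᵥ : ∀ {n k} → Vec (Fin n) k → ℕ
sumᵥ v = sum (tabulate (toℕ ∘ lookup v))

AllEven : ∀ {n k} → Vec (Fin n) k → Set
AllEven v = ∀ i → 2 ∣ toℕ (lookup v i)

allEven? : ∀ {n k} → Decidable (AllEven {n} {k})
allEven? = entrywise? (λ _ y → 2 ∣? toℕ y)

allEven⇒2∣sumᵥ : ∀ {n k} (v : Vec (Fin n) k) → AllEven v → 2 ∣ sumᵥ v
allEven⇒2∣sumᵥ []      _    = 2 ∣0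
allEven⇒2∣sumᵥ (y ∷ v) even = ∣m∣n⇒∣m+n (even fzero) (allEven⇒2∣sumᵥ v (even ∘ fsuc))

count-allEven : ∀ d k → count (allEven? {2 * d} {k}) (allVecs (2 * d) k) ≡ d ^ k
count-allEven d k = begin
  count (allEven? {2 * d} {k}) (allVecs (2 * d) k)
    ≡⟨ count-allVecs (2 * d) k (λ _ y → 2 ∣? toℕ y) ⟩
  product (tabulate {n = k} (λ _ → count (λ y → 2 ∣? toℕ y) (allFin (2 * d))))
    ≡⟨ cong product (tabulate-cong {n = k} (λ _ → count-even d)) ⟩
  product (tabulate {n = k} (λ _ → d))
    ≡⟨ product-tabulate-const k d ⟩
  d ^ k ∎
  where open ≡-Reasoning

AllHalf : ∀ {d k} → Vec (Fin (2 * d)) k → Set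
AllHalf {d} v = ∀ i → toℕ (lookup v i) ≡ d

allHalf? : ∀ {d k} → Decidable (AllHalf {d} {k})
allHalf? {d} = entrywise? (λ _ y → toℕ y ≟ d)

count-allHalf : ∀ d k .{{_ : NonZero d}} → count (allHalf? {d} {k}) (allVecs (2 * d) k) ≡ 1
count-allHalf d k = begin
  count (allHalf? {d} {k}) (allVecs (2 * d) k)
    ≡⟨ count-allVecs (2 * d) k (λ _ y → toℕ y ≟ d) ⟩
  product (tabulate {n = k} (λ _ → count (λ y → toℕ y ≟ d) (allFin (2 * d))))
    ≡⟨ cong product (tabulate-cong {n = k} (λ _ → count-≡half d)) ⟩
  product (tabulate {n = k} (λ _ → 1))
    ≡⟨ product-tabulate-const k 1 ⟩
  1 ^ k
    ≡⟨ ^-zeroˡ k ⟩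
  1 ∎
  where open ≡-Reasoning

EvenOfOrder : ∀ {d r} → Vec ℕ r → Vec (Fin (2 * d)) r → Set
EvenOfOrder {d} m v = ∀ i → HasOrder (2 * d) (lookup v i) (lookup m i) × 2 ∣ toℕ (lookup v i)

evenOfOrder? : ∀ {d r} (m : Vec ℕ r) → Decidable (EvenOfOrder {d} m)
evenOfOrder? {d} m = entrywise? (λ i y → hasOrder? (2 * d) y (lookup m i) ×-dec 2 ∣? toℕ y)

count-evenOfOrder : ∀ d {r} .{{_ : NonZero d}} (m : Vec ℕ r) →
  (∀ i → NonZero (lookup m i)) → (∀ i → lookup m i ∣ d) →
  count (evenOfOrder? {d} m) (allVecs (2 * d) r) ≡ prodφ m
count-evenOfOrder d {r} m m≢0 m∣d = begin
  count (evenOfOrder? {d} m) (allVecs (2 * d) r)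
    ≡⟨ count-allVecs (2 * d) r (λ i y → hasOrder? (2 * d) y (lookup m i) ×-dec 2 ∣? toℕ y) ⟩
  product (tabulate (λ i → count (λ y → hasOrder? (2 * d) y (lookup m i) ×-dec 2 ∣? toℕ y) (allFin (2 * d))))
    ≡⟨ cong product (tabulate-cong (λ i → count-hasOrder-even d (lookup m i) {{m≢0 i}} (m∣d i))) ⟩
  product (tabulate (φ ∘ lookup m))
    ≡⟨ cong product (map-tabulate id (φ ∘ lookup m)) ⟨
  prodφ m ∎
  where open ≡-Reasoning

EvenCancelling : ∀ {d k} → ℕ → Vec (Fin (2 * d)) k → Set
EvenCancelling {d} s v = AllEven v × 2 * d ∣ s + sumᵥ v

evenCancelling? : ∀ {d k} s → Decidable (EvenCancelling {d} {k} s)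
evenCancelling? {d} s v = allEven? v ×-dec (2 * d ∣? s + sumᵥ v)

-- The head of the vector is the unique even residue cancelling s plus the sum of the tail.
count-evenCancelling : ∀ d k .{{_ : NonZero d}} s → 2 ∣ s →
  count (evenCancelling? {d} {suc k} s) (allVecs (2 * d) (suc k)) ≡ d ^ k
count-evenCancelling d k s 2∣s = begin
  count (evenCancelling? {d} s) (allVecs (2 * d) (suc k))
    ≡⟨ cong (count (evenCancelling? {d} s)) (allVecs-suc (2 * d) k) ⟩
  count (evenCancelling? {d} s) (map (λ (v , y) → y ∷ v) pairs)
    ≡⟨ count-map (evenCancelling? {d} s) _ pairs ⟩
  count (λ (v , y) → evenCancelling? {d} s (y ∷ v)) pairs
    ≡⟨ count-cong _ (λ (v , y) → allEven? {2 * d} v ×-dec head? v y) (λ (v , y) → split {v} {y}) pairs ⟩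
  count (λ (v , y) → allEven? {2 * d} v ×-dec head? v y) pairs
    ≡⟨ count-cartesianProduct (allEven? {2 * d}) head? (allVecs (2 * d) k) (allFin (2 * d))
         (λ {v} even → count-even-inverse d (s + sumᵥ v) (∣m∣n⇒∣m+n 2∣s (allEven⇒2∣sumᵥ v even))) ⟩
  count (allEven? {2 * d} {k}) (allVecs (2 * d) k) * 1
    ≡⟨ cong (_* 1) (count-allEven d k) ⟩
  d ^ k * 1
    ≡⟨ *-identityʳ _ ⟩
  d ^ k ∎
  where
  open ≡-Reasoning
  pairs : List (Vec (Fin (2 * d)) k × Fin (2 * d))
  pairs = cartesianProduct (allVecs (2 * d) k) (allFin (2 * d))
  head? : (v : Vec (Fin (2 * d)) k) → Decidable (λ y → 2 * d ∣ s + sumᵥ v + toℕ y × 2 ∣ toℕ y)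
  head? v y = 2 * d ∣? s + sumᵥ v + toℕ y ×-dec 2 ∣? toℕ y
  regroup : ∀ s y t → s + (y + t) ≡ s + t + y
  regroup = solve-∀
  split : ∀ {v y} → EvenCancelling {d} s (y ∷ v) ⇔ (AllEven v × (2 * d ∣ s + sumᵥ v + toℕ y × 2 ∣ toℕ y))
  split {v} {y} = mk⇔
    (λ (even , 2d∣) → even ∘ fsuc , subst (2 * d ∣_) (regroup s (toℕ y) (sumᵥ v)) 2d∣ , even fzero)
    (λ (even , 2d∣ , 2∣y) → (λ { fzero → 2∣y ; (fsuc i) → even i }) ,
                            subst (2 * d ∣_) (sym (regroup s (toℕ y) (sumᵥ v))) 2d∣)

-- Evaluating the relators

∣m+n⇔∣m : ∀ {k m n} → k ∣ n → (k ∣ m + n ⇔ k ∣ m)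
∣m+n⇔∣m {k} {m} {n} k∣n = mk⇔ (λ k∣m+n → ∣m+n∣m⇒∣n (subst (k ∣_) (+-comm m n) k∣m+n) k∣n)
                              (λ k∣m → ∣m∣n⇒∣m+n k∣m k∣n)

mainRelator : ∀ r h 𝔤 → Word r h 𝔤
mainRelator r h 𝔤 = map (λ i → x i , false) (allFin r) ++ map (λ j → e j , false) (allFin h)
                  ++ concatMap (λ k → comm (a k) (b k)) (allFin 𝔤)

module _ {r h 𝔤 : ℕ} (n : ℕ) (ψ : Gen r h 𝔤 → Fin n) where

  evalWord-++ : ∀ w w′ → evalWord n ψ (w ++ w′) ≡ evalWord n ψ w + evalWord n ψ w′
  evalWord-++ []                w′ = refl
  evalWord-++ ((s , false) ∷ w) w′ =
    trans (cong (toℕ (ψ s) +_) (evalWord-++ w w′)) (sym (+-assoc (toℕ (ψ s)) _ _))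
  evalWord-++ ((s , true)  ∷ w) w′ =
    trans (cong (n ∸ toℕ (ψ s) +_) (evalWord-++ w w′)) (sym (+-assoc (n ∸ toℕ (ψ s)) _ _))

  evalWord-positive : ∀ {k} (g : Fin k → B) (s : B → Gen r h 𝔤) →
    evalWord n ψ (map (λ i → s i , false) (tabulate g)) ≡ sum (tabulate (toℕ ∘ ψ ∘ s ∘ g))
  evalWord-positive {k = zero}  g s = refl
  evalWord-positive {k = suc k} g s = cong (toℕ (ψ (s (g fzero))) +_) (evalWord-positive (g ∘ fsuc) s)

  evalWord-replicate : ∀ k s → evalWord n ψ (replicate k (s , false)) ≡ k * toℕ (ψ s)
  evalWord-replicate zero    s = refl
  evalWord-replicate (suc k) s = cong (toℕ (ψ s) +_) (evalWord-replicate k s)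

  -- Each letter y cancels against its inverse, which evaluates to n ∸ y.
  evalWord-comm : ∀ s t w → evalWord n ψ (comm s t ++ w) ≡ n + (n + evalWord n ψ w)
  evalWord-comm s t w = trans (regroup (toℕ (ψ s)) (toℕ (ψ t)) (n ∸ toℕ (ψ s)) (n ∸ toℕ (ψ t)) (evalWord n ψ w))
    (cong₂ _+_ (cancel (ψ s)) (cong (_+ evalWord n ψ w) (cancel (ψ t))))
    where
    regroup : ∀ u v u⁻¹ v⁻¹ w → u + (v + (u⁻¹ + (v⁻¹ + w))) ≡ u + u⁻¹ + (v + v⁻¹ + w)
    regroup = solve-∀
    cancel : ∀ y → toℕ y + (n ∸ toℕ y) ≡ n
    cancel y = m+[n∸m]≡n (<⇒≤ (toℕ<n y))

  n∣evalWord-comm : ∀ s t {w} → n ∣ evalWord n ψ w → n ∣ evalWord n ψ (comm s t ++ w)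
  n∣evalWord-comm s t {w} n∣w =
    subst (n ∣_) (sym (evalWord-comm s t w)) (∣m∣n⇒∣m+n ∣-refl (∣m∣n⇒∣m+n ∣-refl n∣w))

  n∣evalWord-comms : ∀ {k} (f g : Fin k → Gen r h 𝔤) is → n ∣ evalWord n ψ (concatMap (λ i → comm (f i) (g i)) is)
  n∣evalWord-comms f g []       = n ∣0
  n∣evalWord-comms f g (i ∷ is) =
    n∣evalWord-comm (f i) (g i) {concatMap (λ i → comm (f i) (g i)) is} (n∣evalWord-comms f g is)

  n∣mainRelator⇔ : n ∣ evalWord n ψ (mainRelator r h 𝔤) ⇔
                   n ∣ sum (tabulate (toℕ ∘ ψ ∘ x)) + sum (tabulate (toℕ ∘ ψ ∘ e))
  n∣mainRelator⇔ = subst (λ w → n ∣ w ⇔ n ∣ X + E) (sym value) (∣m+n⇔∣m (n∣evalWord-comms a b (allFin 𝔤)))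
    where
    X E W : ℕ
    X = sum (tabulate (toℕ ∘ ψ ∘ x))
    E = sum (tabulate (toℕ ∘ ψ ∘ e))
    W = evalWord n ψ (concatMap (λ k → comm (a k) (b k)) (allFin 𝔤))
    value : evalWord n ψ (mainRelator r h 𝔤) ≡ X + E + W
    value = begin
      evalWord n ψ (mainRelator r h 𝔤)
        ≡⟨ evalWord-++ (map (λ i → x i , false) (allFin r)) _ ⟩
      evalWord n ψ (map (λ i → x i , false) (allFin r)) + evalWord n ψ (map (λ j → e j , false) (allFin h) ++ _)
        ≡⟨ cong₂ _+_ (evalWord-positive id x)
                     (trans (evalWord-++ (map (λ j → e j , false) (allFin h)) _) (cong (_+ W) (evalWord-positive id e))) ⟩
      X + (E + W)
        ≡⟨ +-assoc X E W ⟨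
      X + E + W ∎
      where open ≡-Reasoning

-- Order- and sign-preserving homomorphisms into ℤ_{2d}

module _ {r h 𝔤 : ℕ} (m : Vec ℕ r) (d : ℕ) where

  Conditions : Assignment (2 * d) r h 𝔤 → Set
  Conditions (xs , es , cs , as , bs) =
    EvenOfOrder {d} m xs × EvenCancelling {d} (sumᵥ xs) es × AllHalf {d} cs × AllEven as × AllEven bs

  conditions? : Decidable Conditions
  conditions? (xs , es , cs , as , bs) =
    evenOfOrder? {d} m xs ×-dec evenCancelling? {d} (sumᵥ xs) es ×-dec allHalf? {d} cs ×-dec allEven? as ×-dec allEven? bs

  isHomOPlus⇒conditions : ∀ α → IsHomOPlus (2 * d) m α → Conditions α
  isHomOPlus⇒conditions α@(xs , es , cs , as , bs) (n∣main ∷ _ , x-order , c-order , sign) =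
    (λ i → x-order i , sign (x i)) ,
    ((λ j → sign (e j)) , Equivalence.to (n∣mainRelator⇔ (2 * d) (toMap α)) n∣main) ,
    (λ j → Equivalence.to (hasOrderℕ-two {d} (toℕ<n (lookup cs j))) (c-order j)) ,
    (λ k → sign (a k)) ,
    (λ k → sign (b k))

  conditions⇒isHomOPlus : ¬ 2 ∣ d → ∀ α → Conditions α → IsHomOPlus (2 * d) m α
  conditions⇒isHomOPlus d-odd α@(xs , es , cs , as , bs) (x-ok , (e-even , n∣sum) , c-half , a-even , b-even) =
    isHom , proj₁ ∘ x-ok , (λ j → Equivalence.from (hasOrderℕ-two {d} (toℕ<n (lookup cs j))) (c-half j)) , sign
    where
    ψ : Gen r h 𝔤 → Fin (2 * d)
    ψ = toMap α
    x-power : ∀ i → 2 * d ∣ evalWord (2 * d) ψ (replicate (lookup m i) (x i , false))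
    x-power i = subst (2 * d ∣_) (sym (evalWord-replicate (2 * d) ψ (lookup m i) (x i))) (proj₁ (proj₁ (x-ok i)))
    c-square : ∀ j → 2 * d ∣ evalWord (2 * d) ψ ((c j , false) ∷ (c j , false) ∷ [])
    c-square j = subst (λ v → 2 * d ∣ v + (v + 0)) (sym (c-half j)) ∣-refl
    c-e-commute : ∀ j → 2 * d ∣ evalWord (2 * d) ψ (comm (c j) (e j))
    c-e-commute j = n∣evalWord-comm (2 * d) ψ (c j) (e j) {[]} ((2 * d) ∣0)
    isHom : IsHom (2 * d) m ψ
    isHom = Equivalence.from (n∣mainRelator⇔ (2 * d) ψ) n∣sum
          ∷ ++⁺ (map⁺ (tabulate⁺ x-power)) (++⁺ (map⁺ (tabulate⁺ c-square)) (map⁺ (tabulate⁺ c-e-commute)))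
    sign : ∀ s → SignMatch (σIsPlus s) (ψ s)
    sign (x i) = proj₂ (x-ok i)
    sign (e j) = e-even j
    sign (c j) = d-odd ∘ subst (2 ∣_) (c-half j)
    sign (a k) = a-even k
    sign (b k) = b-even k

  isHomOPlus⇒odd×∣ : Fin h → (∀ i → NonZero (lookup m i)) → ∀ α → IsHomOPlus (2 * d) m α →
                     ¬ 2 ∣ d × (∀ i → lookup m i ∣ d)
  isHomOPlus⇒odd×∣ j m≢0 α hom@(_ , x-order , _ , sign) with isHomOPlus⇒conditions α hom
  ... | x-ok , _ , c-half , _ = sign (c j) ∘ subst (2 ∣_) (sym (c-half j)) , m∣d
    where
    m∣d : ∀ i → lookup m i ∣ d
    m∣d i with proj₂ (x-ok i)
    ... | divides z x≡z*2 = hasOrderℕ⇒∣ {{m≢0 i}} (Equivalence.to (hasOrderℕ-2* d z (lookup m i))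
                              (subst (λ v → HasOrderℕ (2 * d) v (lookup m i)) (trans x≡z*2 (*-comm z 2)) (x-order i)))

count-conditions : ∀ {r h 𝔤} (m : Vec ℕ r) d .{{_ : NonZero d}} →
  (∀ i → NonZero (lookup m i)) → (∀ i → lookup m i ∣ d) →
  count (conditions? m d) (allAssignments (2 * d) r (suc h) 𝔤) ≡ d ^ (2 * 𝔤 + h) * prodφ m
count-conditions {r} {h} {𝔤} m d m≢0 m∣d = begin
  count (conditions? m d) (allAssignments (2 * d) r (suc h) 𝔤)
    ≡⟨ cong (count (conditions? m d)) (allAssignments≡cartesianProduct (2 * d) r (suc h) 𝔤) ⟩
  count (conditions? m d) (cartesianProduct (V r) (cartesianProduct (V (suc h)) cab))
    ≡⟨ count-cartesianProduct (evenOfOrder? {d} m) (λ xs → ecab? (sumᵥ xs)) (V r) _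
         (λ {xs} x-ok → count-ecab (sumᵥ xs) (allEven⇒2∣sumᵥ xs (proj₂ ∘ x-ok))) ⟩
  count (evenOfOrder? {d} m) (V r) * (d ^ h * (1 * (d ^ 𝔤 * d ^ 𝔤)))
    ≡⟨ cong (_* _) (count-evenOfOrder d m m≢0 m∣d) ⟩
  prodφ m * (d ^ h * (1 * (d ^ 𝔤 * d ^ 𝔤)))
    ≡⟨ regroup (prodφ m) (d ^ h) (d ^ 𝔤) ⟩
  d ^ 𝔤 * d ^ 𝔤 * d ^ h * prodφ m
    ≡⟨ cong (_* prodφ m) d^[2𝔤+h] ⟨
  d ^ (2 * 𝔤 + h) * prodφ m ∎
  where
  open ≡-Reasoning
  Vs : ℕ → Set
  Vs k = Vec (Fin (2 * d)) k
  V : ∀ k → List (Vs k)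
  V = allVecs (2 * d)
  cab : List (Vs (suc h) × Vs 𝔤 × Vs 𝔤)
  cab = cartesianProduct (V (suc h)) (cartesianProduct (V 𝔤) (V 𝔤))
  ab? : Decidable (λ ((as , bs) : Vs 𝔤 × Vs 𝔤) → AllEven as × AllEven bs)
  ab? (as , bs) = allEven? as ×-dec allEven? bs
  cab? : Decidable (λ ((cs , as , bs) : Vs (suc h) × Vs 𝔤 × Vs 𝔤) → AllHalf {d} cs × AllEven as × AllEven bs)
  cab? (cs , ab) = allHalf? {d} cs ×-dec ab? ab
  ecab? : ∀ s → Decidable (λ ((es , cs , as , bs) : Vs (suc h) × Vs (suc h) × Vs 𝔤 × Vs 𝔤) →
                             EvenCancelling {d} s es × AllHalf {d} cs × AllEven as × AllEven bs)
  ecab? s (es , cab) = evenCancelling? {d} s es ×-dec cab? cab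
  count-ab : count ab? (cartesianProduct (V 𝔤) (V 𝔤)) ≡ d ^ 𝔤 * d ^ 𝔤
  count-ab = trans (count-cartesianProduct allEven? (λ _ → allEven?) (V 𝔤) (V 𝔤) (λ _ → count-allEven d 𝔤))
                   (cong (_* d ^ 𝔤) (count-allEven d 𝔤))
  count-cab : count cab? cab ≡ 1 * (d ^ 𝔤 * d ^ 𝔤)
  count-cab = trans (count-cartesianProduct (allHalf? {d}) (λ _ → ab?) (V (suc h)) _ (λ _ → count-ab))
                    (cong (_* _) (count-allHalf d (suc h)))
  count-ecab : ∀ s → 2 ∣ s → count (ecab? s) (cartesianProduct (V (suc h)) cab) ≡ d ^ h * (1 * (d ^ 𝔤 * d ^ 𝔤))
  count-ecab s 2∣s = trans (count-cartesianProduct (evenCancelling? {d} s) (λ _ → cab?) (V (suc h)) cab (λ _ → count-cab))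
                           (cong (_* _) (count-evenCancelling d h s 2∣s))
  regroup : ∀ P A B → P * (A * (1 * (B * B))) ≡ B * B * A * P
  regroup = solve-∀
  d^[2𝔤+h] : d ^ (2 * 𝔤 + h) ≡ d ^ 𝔤 * d ^ 𝔤 * d ^ h
  d^[2𝔤+h] = trans (^-distribˡ-+-* d (2 * 𝔤) h)
    (cong (_* d ^ h) (trans (^-distribˡ-+-* d 𝔤 (𝔤 + 0)) (cong (λ t → d ^ 𝔤 * d ^ t) (+-identityʳ 𝔤))))

proposition2 : (𝔤 h r : ℕ) (m : Vec ℕ r) → 1 ≤ h → (∀ i → 1 < lookup m i)
    → (∀ (i j : Fin r) → Data.Fin._≤_ i j → lookup m i ≤ lookup m j)
    → (d : ℕ) → 1 ≤ d
    → (((¬ (2 ∣ d)) × (∀ i → lookup m i ∣ d))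
         → countHomOPlus 𝔤 h r m d ≡ d ^ (2 * 𝔤 + h ∸ 1) * prodφ m)
      × (¬ ((¬ (2 ∣ d)) × (∀ i → lookup m i ∣ d))
         → countHomOPlus 𝔤 h r m d ≡ 0)
proposition2 𝔤 zero    r m ()
proposition2 𝔤 (suc h) r m _ 1<m _ d 1≤d = counted , vanishes
  where
  instance
    d≢0 : NonZero d
    d≢0 = >-nonZero 1≤d
  m≢0 : ∀ i → NonZero (lookup m i)
  m≢0 i = >-nonZero (<-trans z<s (1<m i))
  assignments : List (Assignment (2 * d) r (suc h) 𝔤)
  assignments = allAssignments (2 * d) r (suc h) 𝔤
  counted : ¬ 2 ∣ d × (∀ i → lookup m i ∣ d) →
            countHomOPlus 𝔤 (suc h) r m d ≡ d ^ (2 * 𝔤 + suc h ∸ 1) * prodφ m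
  counted (d-odd , m∣d) = begin
    countHomOPlus 𝔤 (suc h) r m d
      ≡⟨ count-cong (isHomOPlus? (2 * d) m) (conditions? m d)
           (λ α → mk⇔ (isHomOPlus⇒conditions m d α) (conditions⇒isHomOPlus m d d-odd α)) assignments ⟩
    count (conditions? m d) assignments
      ≡⟨ count-conditions m d m≢0 m∣d ⟩
    d ^ (2 * 𝔤 + h) * prodφ m
      ≡⟨ cong (λ k → d ^ (k ∸ 1) * prodφ m) (+-suc (2 * 𝔤) h) ⟨
    d ^ (2 * 𝔤 + suc h ∸ 1) * prodφ m ∎
    where open ≡-Reasoning
  vanishes : ¬ (¬ 2 ∣ d × (∀ i → lookup m i ∣ d)) → countHomOPlus 𝔤 (suc h) r m d ≡ 0
  vanishes ¬odd×∣ =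
    count-none (isHomOPlus? (2 * d) m) (λ α → ¬odd×∣ ∘ isHomOPlus⇒odd×∣ m d fzero m≢0 α) assignments
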